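{- Let $k\geq 2$ and $n\geq 1$ be integers, let $t_1,\dots,t_k$ be indeterminates, and work in the field $\mathbb{C}(t_1,\dots,t_k)$ of rational functions. Set $t_0=1$. Let $B_{k,n}=(b_{rs})_{1\le r,s\le n}$ be the $n\times n$ lower Hessenberg matrix with $$b_{rs}=\begin{cases} -t_2 & \text{if } s=r+1,\\[1mm] \dfrac{t_{r-s+1}}{t_2^{\,r-s}} & \text{if } 0\leq r-s<k,\\[2mm] 0 & \text{otherwise.}\end{cases}$$ (Thus the diagonal entries are $t_1$, the subdiagonal entries are $1$, and the entries with $r-s=d$, $2\le d\le k-1$, are $t_{d+1}/t_2^{d}$.) Then $$\det(B_{k,n})=F_{k,n+1}(t).$$
   Context: The generalized Fibonacci polynomials $F_{k,n}(t)$, $t=(t_1,\dots,t_k)$, are defined by $F_{k,n}(t)=0$ for $n<1$, $F_{k,1}(t)=1$, $F_{k,2}(t)=t_1$, and $F_{k,n+1}(t)=t_1F_{k,n}(t)+t_2F_{k,n-1}(t)+\cdots+t_kF_{k,n-k+1}(t)$ for $n\ge 1$. -}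

module Defs where

open import Level using (Level)
open import Algebra.Bundles using (CommutativeRing)
open import Data.Nat using (ℕ; zero; suc; _∸_; _<?_)
open import Data.Fin using (Fin; zero; suc; punchIn; fromℕ<)
open import Data.List using (List; []; _∷_)
open import Relation.Nullary using (yes; no)

module _ {c ℓ : Level} (R : CommutativeRing c ℓ) where
  open CommutativeRing R hiding (zero)

  pow : Carrier → ℕ → Carrier
  pow x zero = 1#
  pow x (suc m) = x * pow x m

  alt : ℕ → Carrier
  alt zero = 1#
  alt (suc m) = - alt m

  sumFin : (n : ℕ) → (Fin n → Carrier) → Carrier
  sumFin zero f = 0#
  sumFin (suc n) f = f zero + sumFin n (λ i → f (suc i))

  det : (n : ℕ) → (Fin n → Fin n → Carrier) → Carrier
  det zero M = 1#
  det (suc n) M =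
    sumFin (suc n) (λ j → alt (Data.Fin.toℕ j) * (M zero j * det n (λ r s → M (suc r) (punchIn j s))))

  -- 1-based access to the indeterminates t = (t₁,…,tₖ), given as t : Fin k → Carrier
  -- (t i stands for t_{i+1}); tt k t 0 = t₀ = 1, and indices > k give 0 (never used).
  tt : (k : ℕ) → (Fin k → Carrier) → ℕ → Carrier
  tt k t zero = 1#
  tt k t (suc d) with d <? k
  ... | yes d<k = t (fromℕ< d<k)
  ... | no _ = 0#

  nth0 : List Carrier → ℕ → Carrier
  nth0 [] _ = 0#
  nth0 (x ∷ xs) zero = x
  nth0 (x ∷ xs) (suc i) = nth0 xs i

  -- fibHist k t n = [F_{k,n}, F_{k,n-1}, …, F_{k,0}]
  fibHist : (k : ℕ) → (Fin k → Carrier) → ℕ → List Carrier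
  fibHist k t zero = 0# ∷ []
  fibHist k t (suc zero) = 1# ∷ 0# ∷ []
  fibHist k t (suc (suc m)) =
    let h = fibHist k t (suc m) in
    sumFin k (λ i → t i * nth0 h (Data.Fin.toℕ i)) ∷ h

  -- generalized Fibonacci polynomial F_{k,n}(t) (n ≥ 0; F_{k,0} = 0, F_{k,1} = 1,
  -- F_{k,n+1} = t₁F_{k,n} + … + t_kF_{k,n-k+1}, with F of negative index = 0)
  Fib : (k : ℕ) → (Fin k → Carrier) → ℕ → Carrier
  Fib k t n = nth0 (fibHist k t n) zero

  -- the matrix B_{k,n}, 0-based indices i = r-1, j = s-1; u is the inverse of t₂
  B : (k : ℕ) → (Fin k → Carrier) → (u : Carrier) → (n : ℕ) → Fin n → Fin n → Carrier
  B k t u n i j with suc (Data.Fin.toℕ i) Data.Nat.≟ Data.Fin.toℕ j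
  ... | yes _ = - tt k t 2
  ... | no _ with Data.Fin.toℕ j Data.Nat.≤? Data.Fin.toℕ i
  ...   | no _ = 0#
  ...   | yes _ with (Data.Fin.toℕ i ∸ Data.Fin.toℕ j) <? k
  ...     | yes _ = tt k t (suc (Data.Fin.toℕ i ∸ Data.Fin.toℕ j)) * pow u (Data.Fin.toℕ i ∸ Data.Fin.toℕ j)
  ...     | no _ = 0#

{-# OPTIONS --safe #-}
-- Both B_{k,n} and the Fibonacci polynomials are governed by the same full-history
-- recurrence.  B_{k,n} is lower Hessenberg and Toeplitz, with e₀ = -t₂ on the
-- superdiagonal and e_{d+1} = t_{d+1}/t₂^d on the d-th subdiagonal.  Expanding along
-- the first row, whose only nonzero entries are e₁ and e₀, and iterating on the minor
-- that keeps the first column gives Trudi's recurrence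
--   D_{m+1} = Σ_{d≤m} (-e₀)^d e_{d+1} D_{m-d},
-- and (-e₀)^d e_{d+1} = t₂^d t_{d+1}/t₂^d = t_{d+1}.  So D_m and F_{k,m+1} satisfy the
-- same recurrence with the same initial value, hence coincide.
module Submission where

open import Defs
open import Level using (Level)
open import Algebra.Bundles using (CommutativeRing)
open import Data.Nat as ℕ using (ℕ; zero; suc; _∸_; _≤_; _<_; z≤n; s≤s; _≟_; _≤?_; _<?_)
open import Data.Nat.Properties
  using (m∸n≤m; m≤n⇒m≤1+n; +-∸-assoc; ≰⇒>; ≮⇒≥; <⇒≱; ≤∧≢⇒<) renaming (+-comm to ℕ-+-comm)
open import Data.Nat.Induction using (<-rec)
open import Data.Fin using (Fin; toℕ; punchIn)
open import Data.Fin.Properties using (toℕ<n; fromℕ<-toℕ)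
open import Relation.Binary.PropositionalEquality as ≡ using (_≡_)
open import Relation.Nullary using (yes; no)
open import Relation.Nullary.Negation using (contradiction)
import Algebra.Properties.Ring as RingProperties
import Algebra.Properties.CommutativeSemigroup as CommutativeSemigroupProperties
import Relation.Binary.Reasoning.Setoid as SetoidReasoning

module HessenbergFibonacci {c ℓ : Level} (R : CommutativeRing c ℓ) where
  open CommutativeRing R hiding (zero)
  open RingProperties ring using (-1*x≈-x; -‿distribˡ-*; -‿involutive)
  open CommutativeSemigroupProperties *-commutativeSemigroup using (interchange)
  open SetoidReasoning setoid

  sumFin-cong : ∀ n {f g : Fin n → Carrier} → (∀ i → f i ≈ g i) → sumFin R n f ≈ sumFin R n g
  sumFin-cong zero    f≈g = refl
  sumFin-cong (suc n) f≈g = +-cong (f≈g Fin.zero) (sumFin-cong n (λ i → f≈g (Fin.suc i)))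

  sumFin-zero : ∀ n (f : Fin n → Carrier) → (∀ i → f i ≈ 0#) → sumFin R n f ≈ 0#
  sumFin-zero zero    f f≈0 = refl
  sumFin-zero (suc n) f f≈0 = trans (+-cong (f≈0 Fin.zero) (sumFin-zero n _ (λ i → f≈0 (Fin.suc i)))) (+-identityʳ 0#)

  *-distribˡ-sumFin : ∀ n x (f : Fin n → Carrier) → x * sumFin R n f ≈ sumFin R n (λ i → x * f i)
  *-distribˡ-sumFin zero    x f = zeroʳ x
  *-distribˡ-sumFin (suc n) x f = trans (distribˡ x _ _) (+-congˡ (*-distribˡ-sumFin n x (λ i → f (Fin.suc i))))

  sumTo : ℕ → (ℕ → Carrier) → Carrier
  sumTo n f = sumFin R n (λ i → f (toℕ i))

  sumTo-cong : ∀ n (f g : ℕ → Carrier) → (∀ d → d < n → f d ≈ g d) → sumTo n f ≈ sumTo n g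
  sumTo-cong n f g f≈g = sumFin-cong n (λ i → f≈g (toℕ i) (toℕ<n i))

  sumTo-padʳ : ∀ n p (f : ℕ → Carrier) → (∀ d → n ≤ d → f d ≈ 0#) → sumTo (n ℕ.+ p) f ≈ sumTo n f
  sumTo-padʳ zero    p f f≈0 = sumFin-zero p _ (λ i → f≈0 (toℕ i) z≤n)
  sumTo-padʳ (suc n) p f f≈0 = +-congˡ (sumTo-padʳ n p (λ d → f (suc d)) (λ d n≤d → f≈0 (suc d) (s≤s n≤d)))

  infixr 8 _^_
  _^_ : Carrier → ℕ → Carrier
  x ^ d = pow R x d

  ^-congˡ : ∀ d {x y} → x ≈ y → x ^ d ≈ y ^ d
  ^-congˡ zero    _   = refl
  ^-congˡ (suc d) x≈y = *-cong x≈y (^-congˡ d x≈y)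

  ^-inverse : ∀ {w u} → w * u ≈ 1# → ∀ d → w ^ d * u ^ d ≈ 1#
  ^-inverse wu≈1 zero = *-identityˡ 1#
  ^-inverse {w} {u} wu≈1 (suc d) = begin
    (w * w ^ d) * (u * u ^ d)  ≈⟨ interchange w (w ^ d) u (u ^ d) ⟩
    (w * u) * (w ^ d * u ^ d)  ≈⟨ *-cong wu≈1 (^-inverse wu≈1 d) ⟩
    1# * 1#                    ≈⟨ *-identityˡ 1# ⟩
    1#                         ∎

  det-cong : ∀ n {M M′ : Fin n → Fin n → Carrier} → (∀ i j → M i j ≈ M′ i j) → det R n M ≈ det R n M′
  det-cong zero    M≈M′ = refl
  det-cong (suc n) {M} {M′} M≈M′ = +-cong (term≈ Fin.zero) (sumFin-cong n (λ j → term≈ (Fin.suc j)))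
    where
    term≈ : ∀ j → alt R (toℕ j) * (M Fin.zero j * det R n (λ r s → M (Fin.suc r) (punchIn j s)))
                 ≈ alt R (toℕ j) * (M′ Fin.zero j * det R n (λ r s → M′ (Fin.suc r) (punchIn j s)))
    term≈ j = *-congˡ (*-cong (M≈M′ Fin.zero j) (det-cong n (λ r s → M≈M′ (Fin.suc r) (punchIn j s))))

  Recurrence : (ℕ → Carrier) → (ℕ → Carrier) → Set ℓ
  Recurrence coeff a = ∀ m → a (suc m) ≈ sumTo (suc m) (λ d → coeff d * a (m ∸ d))

  recurrence-unique : ∀ {coeff a b} → Recurrence coeff a → Recurrence coeff b → a 0 ≈ b 0 →
                      ∀ n → a n ≈ b n
  recurrence-unique {coeff} {a} {b} rec-a rec-b a₀≈b₀ = <-rec (λ n → a n ≈ b n) step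
    where
    step : ∀ n → (∀ {m} → m < n → a m ≈ b m) → a n ≈ b n
    step zero    _  = a₀≈b₀
    step (suc m) ih = begin
      a (suc m)                                    ≈⟨ rec-a m ⟩
      sumTo (suc m) (λ d → coeff d * a (m ∸ d))    ≈⟨ sumTo-cong (suc m) _ _ (λ d _ → *-congˡ {coeff d} (ih (s≤s (m∸n≤m m d)))) ⟩
      sumTo (suc m) (λ d → coeff d * b (m ∸ d))    ≈⟨ rec-b m ⟨
      b (suc m)                                    ∎

  module HessenbergToeplitz (e : ℕ → Carrier) where

    -- e 0 on the superdiagonal, e (1 + d) on the d-th subdiagonal, 0 above the superdiagonal.
    H : ℕ → ℕ → Carrier
    H i             zero          = e (suc i)
    H zero          (suc zero)    = e 0
    H zero          (suc (suc j)) = 0#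
    H (suc i)       (suc j)       = H i j

    H-superdiagonal : ∀ i → H i (suc i) ≡ e 0
    H-superdiagonal zero    = ≡.refl
    H-superdiagonal (suc i) = H-superdiagonal i

    H-lowerTriangle : ∀ {i j} → j ≤ i → H i j ≡ e (suc (i ∸ j))
    H-lowerTriangle {i}     {zero}  _         = ≡.refl
    H-lowerTriangle {suc i} {suc j} (s≤s j≤i) = H-lowerTriangle j≤i

    H-aboveSuperdiagonal : ∀ {i j} → suc i < j → H i j ≡ 0#
    H-aboveSuperdiagonal {zero}  {suc zero}    (s≤s ())
    H-aboveSuperdiagonal {zero}  {suc (suc j)} _         = ≡.refl
    H-aboveSuperdiagonal {suc i} {suc j}       (s≤s i<j) = H-aboveSuperdiagonal i<j

    withColumn₀ : (ℕ → Carrier) → ℕ → ℕ → Carrier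
    withColumn₀ f i zero    = f i
    withColumn₀ f i (suc j) = H i (suc j)

    detH : ℕ → Carrier
    detH n = det R n (λ i j → H (toℕ i) (toℕ j))

    detH₀ : (ℕ → Carrier) → ℕ → Carrier
    detH₀ f n = det R n (λ i j → withColumn₀ f (toℕ i) (toℕ j))

    detH≈detH₀ : ∀ n → detH n ≈ detH₀ (λ i → e (suc i)) n
    detH≈detH₀ n = det-cong n λ { i Fin.zero → refl ; i (Fin.suc j) → refl }

    detH₀-one : ∀ f → detH₀ f 1 ≈ f 0
    detH₀-one f = trans (+-identityʳ _) (trans (*-identityˡ _) (*-identityʳ _))

    -- Only the first two entries of the top row are nonzero; deleting column 0 leaves the
    -- Toeplitz matrix itself, deleting column 1 keeps the shifted column f.
    detH₀-expand : ∀ f m → detH₀ f (suc (suc m)) ≈ f 0 * detH (suc m) + (- e 0) * detH₀ (λ i → f (suc i)) (suc m)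
    detH₀-expand f m = +-cong (*-identityˡ _) (trans (+-congˡ later-columns≈0) (trans (+-identityʳ _) second-column))
      where
      M : Fin (suc (suc m)) → Fin (suc (suc m)) → Carrier
      M i j = withColumn₀ f (toℕ i) (toℕ j)
      minor₁ : Fin (suc m) → Fin (suc m) → Carrier
      minor₁ r s = M (Fin.suc r) (punchIn (Fin.suc Fin.zero) s)
      minor₁≈ : ∀ r s → minor₁ r s ≈ withColumn₀ (λ i → f (suc i)) (toℕ r) (toℕ s)
      minor₁≈ r Fin.zero    = refl
      minor₁≈ r (Fin.suc s) = refl
      later-columns≈0 : sumFin R m (λ j → alt R (toℕ (Fin.suc (Fin.suc j))) * (M Fin.zero (Fin.suc (Fin.suc j)) *
                          det R (suc m) (λ r s → M (Fin.suc r) (punchIn (Fin.suc (Fin.suc j)) s)))) ≈ 0#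
      later-columns≈0 = sumFin-zero m _ (λ j → trans (*-congˡ (zeroˡ _)) (zeroʳ _))
      second-column : (- 1#) * (e 0 * det R (suc m) minor₁) ≈ (- e 0) * detH₀ (λ i → f (suc i)) (suc m)
      second-column = begin
        (- 1#) * (e 0 * det R (suc m) minor₁)       ≈⟨ -1*x≈-x _ ⟩
        - (e 0 * det R (suc m) minor₁)              ≈⟨ -‿distribˡ-* _ _ ⟩
        (- e 0) * det R (suc m) minor₁              ≈⟨ *-congˡ (det-cong (suc m) minor₁≈) ⟩
        (- e 0) * detH₀ (λ i → f (suc i)) (suc m)  ∎

    detH₀-expansion : ∀ m f → detH₀ f (suc m) ≈ sumTo (suc m) (λ d → ((- e 0) ^ d * f d) * detH (m ∸ d))
    detH₀-expansion zero f = begin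
      detH₀ f 1          ≈⟨ detH₀-one f ⟩
      f 0                ≈⟨ *-identityʳ (f 0) ⟨
      f 0 * 1#           ≈⟨ *-congʳ (*-identityˡ (f 0)) ⟨
      (1# * f 0) * 1#    ≈⟨ +-identityʳ _ ⟨
      sumTo 1 (λ d → ((- e 0) ^ d * f d) * detH (0 ∸ d))  ∎
    detH₀-expansion (suc m) f = begin
      detH₀ f (suc (suc m))
        ≈⟨ detH₀-expand f m ⟩
      f 0 * detH (suc m) + (- e 0) * detH₀ (λ i → f (suc i)) (suc m)
        ≈⟨ +-cong (*-congʳ (sym (*-identityˡ (f 0)))) (*-congˡ (detH₀-expansion m (λ i → f (suc i)))) ⟩
      (1# * f 0) * detH (suc m) + (- e 0) * sumTo (suc m) (λ d → ((- e 0) ^ d * f (suc d)) * detH (m ∸ d))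
        ≈⟨ +-congˡ (*-distribˡ-sumFin (suc m) (- e 0) (λ i → term (toℕ i))) ⟩
      (1# * f 0) * detH (suc m) + sumTo (suc m) (λ d → (- e 0) * term d)
        ≈⟨ +-congˡ (sumTo-cong (suc m) (λ d → (- e 0) * term d) (λ d → ((- e 0) ^ suc d * f (suc d)) * detH (m ∸ d))
                      (λ d _ → trans (sym (*-assoc _ _ _)) (*-congʳ (sym (*-assoc _ _ _))))) ⟩
      sumTo (suc (suc m)) (λ d → ((- e 0) ^ d * f d) * detH (suc m ∸ d))
        ∎
      where
      term : ℕ → Carrier
      term d = ((- e 0) ^ d * f (suc d)) * detH (m ∸ d)

    detH-recurrence : Recurrence (λ d → (- e 0) ^ d * e (suc d)) detH
    detH-recurrence m = trans (detH≈detH₀ (suc m)) (detH₀-expansion m (λ i → e (suc i)))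

  module Fibonacci (k : ℕ) (t : Fin k → Carrier) where

    T : ℕ → Carrier
    T d = tt R k t (suc d)

    T-toℕ : ∀ i → T (toℕ i) ≡ t i
    T-toℕ i with toℕ i <? k
    ... | yes i<k = ≡.cong t (fromℕ<-toℕ i i<k)
    ... | no  i≮k = contradiction (toℕ<n i) i≮k

    T-beyond : ∀ {d} → k ≤ d → T d ≡ 0#
    T-beyond {d} k≤d with d <? k
    ... | yes d<k = contradiction k≤d (<⇒≱ d<k)
    ... | no  _   = ≡.refl

    history : ℕ → ℕ → Carrier
    history n = nth0 R (fibHist R k t n)

    history-suc : ∀ n d → history (suc n) (suc d) ≡ history n d
    history-suc zero    d = ≡.refl
    history-suc (suc n) d = ≡.refl

    history-beyond : ∀ {n d} → n ≤ d → history n d ≡ 0#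
    history-beyond {zero}  {zero}  _         = ≡.refl
    history-beyond {zero}  {suc d} _         = ≡.refl
    history-beyond {suc n} {suc d} (s≤s n≤d) = ≡.trans (history-suc n d) (history-beyond n≤d)

    history-lookup : ∀ {n d} → d ≤ n → history n d ≡ Fib R k t (n ∸ d)
    history-lookup {n}     {zero}  _         = ≡.refl
    history-lookup {suc n} {suc d} (s≤s d≤n) = ≡.trans (history-suc n d) (history-lookup d≤n)

    Fib-recurrence : Recurrence T (λ n → Fib R k t (suc n))
    Fib-recurrence m = begin
      Fib R k t (suc (suc m))
        ≈⟨ sumFin-cong k (λ i → *-congʳ (reflexive (≡.sym (T-toℕ i)))) ⟩
      sumTo k φ
        ≈⟨ sumTo-padʳ k (suc m) φ (λ d k≤d → trans (*-congʳ (reflexive (T-beyond k≤d))) (zeroˡ _)) ⟨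
      sumTo (k ℕ.+ suc m) φ
        ≡⟨ ≡.cong (λ n → sumTo n φ) (ℕ-+-comm k (suc m)) ⟩
      sumTo (suc m ℕ.+ k) φ
        ≈⟨ sumTo-padʳ (suc m) k φ (λ d m<d → trans (*-congˡ (reflexive (history-beyond m<d))) (zeroʳ _)) ⟩
      sumTo (suc m) φ
        ≈⟨ sumTo-cong (suc m) φ _ (λ d d≤m → *-congˡ (reflexive (shift d≤m))) ⟩
      sumTo (suc m) (λ d → T d * Fib R k t (suc (m ∸ d)))
        ∎
      where
      φ : ℕ → Carrier
      φ d = T d * history (suc m) d
      shift : ∀ {d} → suc d ≤ suc m → history (suc m) d ≡ Fib R k t (suc (m ∸ d))
      shift {d} (s≤s d≤m) = ≡.trans (history-lookup (m≤n⇒m≤1+n d≤m)) (≡.cong (Fib R k t) (+-∸-assoc 1 d≤m))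

  module MatrixB (k : ℕ) (t : Fin k → Carrier) (u : Carrier) where
    open Fibonacci k t using (T; T-beyond)

    e : ℕ → Carrier
    e zero    = - tt R k t 2
    e (suc d) = T d * u ^ d

    open HessenbergToeplitz e using (H; H-superdiagonal; H-lowerTriangle; H-aboveSuperdiagonal; detH; detH-recurrence)

    B≈H : ∀ n i j → B R k t u n i j ≈ H (toℕ i) (toℕ j)
    B≈H n i j with suc (toℕ i) ≟ toℕ j
    ... | yes i+1≡j = reflexive (≡.sym (≡.trans (≡.cong (H (toℕ i)) (≡.sym i+1≡j)) (H-superdiagonal (toℕ i))))
    ... | no  i+1≢j with toℕ j ≤? toℕ i
    ...   | no  j≰i = reflexive (≡.sym (H-aboveSuperdiagonal (≤∧≢⇒< (≰⇒> j≰i) i+1≢j)))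
    ...   | yes j≤i with (toℕ i ∸ toℕ j) <? k
    ...     | yes _   = reflexive (≡.sym (H-lowerTriangle j≤i))
    ...     | no  i-j≮k = sym (begin
      H (toℕ i) (toℕ j)                       ≡⟨ H-lowerTriangle j≤i ⟩
      T (toℕ i ∸ toℕ j) * u ^ (toℕ i ∸ toℕ j)  ≈⟨ *-congʳ (reflexive (T-beyond (≮⇒≥ i-j≮k))) ⟩
      0# * u ^ (toℕ i ∸ toℕ j)                 ≈⟨ zeroˡ _ ⟩
      0#                                      ∎)

    -- The powers of u = 1/t₂ in the subdiagonals cancel against the powers of -e₀ = t₂.
    detH-fibonacciRecurrence : tt R k t 2 * u ≈ 1# → Recurrence T detH
    detH-fibonacciRecurrence t₂u≈1 m = trans (detH-recurrence m)
      (sumTo-cong (suc m) _ (λ d → T d * detH (m ∸ d)) (λ d _ → *-congʳ (coefficient d)))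
      where
      coefficient : ∀ d → (- e 0) ^ d * (T d * u ^ d) ≈ T d
      coefficient d = begin
        (- - tt R k t 2) ^ d * (T d * u ^ d)  ≈⟨ *-cong (^-congˡ d (-‿involutive _)) (*-comm (T d) _) ⟩
        tt R k t 2 ^ d * (u ^ d * T d)        ≈⟨ *-assoc _ _ _ ⟨
        (tt R k t 2 ^ d * u ^ d) * T d        ≈⟨ *-congʳ (^-inverse t₂u≈1 d) ⟩
        1# * T d                              ≈⟨ *-identityˡ (T d) ⟩
        T d                                   ∎

theorem2p5 : {c ℓ : Level} (R : CommutativeRing c ℓ) (k : ℕ) → 2 ≤ k → (n : ℕ) → 1 ≤ n →
    (t : Fin k → CommutativeRing.Carrier R) (u : CommutativeRing.Carrier R) →
    CommutativeRing._≈_ R (CommutativeRing._*_ R (tt R k t 2) u) (CommutativeRing.1# R) →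
    CommutativeRing._≈_ R (det R n (B R k t u n)) (Fib R k t (suc n))
theorem2p5 R k _ n _ t u t₂u≈1 = begin
  det R n (B R k t u n)  ≈⟨ det-cong n (B≈H n) ⟩
  detH n                 ≈⟨ recurrence-unique {coeff = T} (detH-fibonacciRecurrence t₂u≈1) Fib-recurrence refl n ⟩
  Fib R k t (suc n)      ∎
  where
  open CommutativeRing R using (setoid; refl)
  open SetoidReasoning setoid
  open HessenbergFibonacci R
  open Fibonacci k t using (T; Fib-recurrence)
  open MatrixB k t u
  open HessenbergToeplitz e using (detH)
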